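{- For every integer $d \ge 3$ there is a constant $f(d)$ (depending only on $d$) such that for every $h \ge 1$ the partial order $\mathcal{T}^h$ has a $d$-hitting family of schedules of size at most $f(d)\, h^{d-1}$ (i.e. of size $O(h^{d-1})$, which is $O((\log n)^{d-1})$ where $n = 2^{h+1}-1$ is the number of elements of $\mathcal{T}^h$).
   Context: $\mathcal{T}^h$ is the partial order on the set $\{0,1\}^{\le h}$ of binary strings of length at most $h$, where $x \le y$ iff $x$ is a prefix of $y$ (the complete binary tree of height $h$). A schedule of a finite partial order $(P,\le)$ is a linear extension of it. A $d$-tuple $(a_1,\dots,a_d)$ of distinct elements of $P$ is admissible if for all $i<j$ either $a_i \le a_j$ or $a_i,a_j$ are incomparable. A schedule hits $(a_1,\dots,a_d)$ if its restriction to $\{a_1,\dots,a_d\}$ is the sequence $a_1,\dots,a_d$. A family of schedules is $d$-hitting if every admissible $d$-tuple is hit by some schedule in the family. -}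

module Defs where

open import Data.Bool using (Bool)
open import Data.Nat using (ℕ; _≤_)
open import Data.Fin using (Fin) renaming (_<_ to _<ᶠ_)
open import Data.List using (List; []; _∷_; _++_; length; filter)
open import Data.List.Properties using (≡-dec)
open import Data.List.Membership.Propositional using (_∈_)
open import Data.List.Membership.DecPropositional (≡-dec Data.Bool._≟_) using (_∈?_)
open import Data.List.Relation.Unary.Unique.Propositional using (Unique)
open import Data.Vec using (Vec; lookup; toList)
open import Data.Product using (Σ; ∃; _×_)
open import Data.Sum using (_⊎_)
open import Relation.Nullary using (¬_)
open import Relation.Binary.PropositionalEquality using (_≡_; _≢_)

Str : Set
Str = List Bool

-- The order of T^h: x ≤ y iff x is a prefix of y.
_⊑_ : Str → Str → Set
x ⊑ y = ∃ λ z → x ++ z ≡ y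

InT : ℕ → Str → Set
InT h x = length x ≤ h

Before : List Str → Str → Str → Set
Before s x y = Σ (List Str) λ s₁ → Σ (List Str) λ s₂ → s ≡ s₁ ++ (x ∷ s₂) × y ∈ s₂

record Schedule (h : ℕ) : Set where
  field
    order    : List Str
    unique   : Unique order
    sound    : ∀ x → x ∈ order → InT h x
    complete : ∀ x → InT h x → x ∈ order
    monotone : ∀ x y → InT h x → InT h y → x ⊑ y → x ≢ y → Before order x y
open Schedule public

Admissible : (h d : ℕ) → Vec Str d → Set
Admissible h d a =
  (∀ i → InT h (lookup a i)) ×
  (∀ i j → lookup a i ≡ lookup a j → i ≡ j) ×
  (∀ i j → i <ᶠ j →
     lookup a i ⊑ lookup a j ⊎ (¬ (lookup a i ⊑ lookup a j) × ¬ (lookup a j ⊑ lookup a i)))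

Hits : {h d : ℕ} → Schedule h → Vec Str d → Set
Hits s a = filter (_∈? toList a) (order s) ≡ toList a

Hitting : (h d : ℕ) → List (Schedule h) → Set
Hitting h d F = ∀ (a : Vec Str d) → Admissible h d a →
  ∃ λ s → s ∈ F × Hits s a

-- A schedule is given by a vector Q of d − 1 depths and patterns b₁, …, b_d, each prescribing a
-- bit (or its absence) at every depth of Q: first come, in preorder, the strings matching b₁, then
-- the remaining strings matching b₂, and so on. A string matches a pattern if its bits at the
-- depths of Q agree with the pattern wherever the string is long enough; this is inherited by
-- prefixes, so the listing is a linear extension of T^h. For an admissible tuple a₁, …, a_d take
-- the depths q_j = max_{k<j} lcp(a_j, a_k) (2 ≤ j ≤ d) and let b_i record the bits of a_i at them.
-- By the ultrametric inequality for lcp, every branching depth lcp(a_i, a_j) is one of the q's, so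
-- a_j does not match b_i for i < j, and the schedule hits the tuple. There are h^(d−1) choices of
-- Q and 3^(d(d−1)) choices of the patterns.
module Submission where

open import Defs
open import Data.Bool using (Bool; true; false; _∧_) renaming (_≟_ to _≟ᵇ_)
open import Data.Empty using (⊥-elim)
open import Data.Fin using (Fin; zero; suc; toℕ; fromℕ<) renaming (_<_ to _<ᶠ_)
import Data.Fin.Properties as Fin
open import Data.List
  using (List; []; _∷_; _++_; [_]; length; map; filter; upTo; head; drop; cartesianProductWith)
open import Data.List.Extrema.Nat using (argmax; argmax-all; f[xs]≤f[argmax])
open import Data.List.Membership.Propositional using (_∈_)
open import Data.List.Membership.Propositional.Properties
  using (∈-++⁺ˡ; ∈-++⁺ʳ; ∈-++⁻; ∈-∃++; ∈-map⁺; ∈-map⁻; ∈-filter⁺; ∈-filter⁻; ∈-upTo⁺; ∈-upTo⁻;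
         ∈-cartesianProductWith⁺)
open import Data.List.Properties
  using (++-assoc; map-++; filter-++; filter-accept; filter-none;
         length-++; length-map; length-upTo; ++-identityʳ; ++-identityʳ-unique; ++-conicalˡ;
         ∷-injectiveʳ)
import Data.List.Relation.Unary.All as All
import Data.List.Relation.Unary.All.Properties as All
open import Data.List.Relation.Unary.Any using (here; there)
open import Data.List.Relation.Unary.Unique.Propositional using (Unique; []; _∷_)
import Data.List.Relation.Unary.Unique.Propositional.Properties as Unique
open import Data.Maybe using (Maybe; just; nothing)
open import Data.Nat using (ℕ; zero; suc; _+_; _*_; _^_; _∸_; _≤_; _<_; z≤n; s≤s; z<s; _≟_)
open import Data.Nat.Induction using (<-rec)
open import Data.Nat.Properties
open import Data.Product using (Σ; ∃; _×_; _,_; proj₁; proj₂)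
open import Data.Sum using (_⊎_; inj₁; inj₂)
open import Data.Vec as Vec using (Vec; []; _∷_; lookup; toList)
import Data.Vec.Relation.Unary.All as VecAll
import Data.Vec.Relation.Unary.All.Properties as VecAll
import Data.Vec.Relation.Unary.Any as VecAny
import Data.Vec.Relation.Unary.Any.Properties as VecAny
open import Data.Vec.Membership.Propositional.Properties using (∈-toList⁻; ∈-toList⁺; ∈-lookup)
open import Data.Vec.Properties using (lookup-map; lookup∘tabulate)
open import Function using (_∘_; case_of_)
open import Relation.Binary using (Tri; tri<; tri≈; tri>)
open import Relation.Binary.PropositionalEquality
  using (_≡_; _≢_; refl; sym; trans; cong; cong₂; cong-app; subst; subst₂; module ≡-Reasoning)
open import Relation.Nullary using (¬_; yes; no; does; contradiction)
open import Relation.Unary using (Decidable)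

Before-++ˡ : ∀ {xs x y} ys → Before xs x y → Before (xs ++ ys) x y
Before-++ˡ ys (s₁ , s₂ , refl , y∈) = s₁ , s₂ ++ ys , ++-assoc s₁ _ ys , ∈-++⁺ˡ y∈

Before-++ʳ : ∀ {ys x y} xs → Before ys x y → Before (xs ++ ys) x y
Before-++ʳ xs (s₁ , s₂ , refl , y∈) = xs ++ s₁ , s₂ , sym (++-assoc xs s₁ _) , y∈

Before-++ : ∀ {xs ys x y} → x ∈ xs → y ∈ ys → Before (xs ++ ys) x y
Before-++ {ys = ys} x∈ y∈ with s₁ , s₂ , refl ← ∈-∃++ x∈ =
  s₁ , s₂ ++ ys , ++-assoc s₁ _ ys , ∈-++⁺ʳ s₂ y∈

Before-map : ∀ {s x y} (f : Str → Str) → Before s x y → Before (map f s) (f x) (f y)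
Before-map f (s₁ , s₂ , refl , y∈) = map f s₁ , map f s₂ , map-++ f s₁ _ , ∈-map⁺ f y∈

Before-filter : ∀ {P : Str → Set} (P? : Decidable P) {s x y} →
  P x → P y → Before s x y → Before (filter P? s) x y
Before-filter P? {x = x} Px Py (s₁ , s₂ , refl , y∈) =
  filter P? s₁ , filter P? s₂ ,
  trans (filter-++ P? s₁ (x ∷ s₂)) (cong (filter P? s₁ ++_) (filter-accept P? Px)) ,
  ∈-filter⁺ P? y∈ Py

Before⇒∈ˡ : ∀ {s x y} → Before s x y → x ∈ s
Before⇒∈ˡ (s₁ , _ , refl , _) = ∈-++⁺ʳ s₁ (here refl)

Before⇒∈ʳ : ∀ {s x y} → Before s x y → y ∈ s
Before⇒∈ʳ (s₁ , _ , refl , y∈) = ∈-++⁺ʳ s₁ (there y∈)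

filter-singleton : ∀ {P : Str → Set} (P? : Decidable P) {xs y} → Unique xs → y ∈ xs → P y →
  (∀ {x} → x ∈ xs → P x → x ≡ y) → filter P? xs ≡ [ y ]
filter-singleton {P} P? {y ∷ xs} (y∉ ∷ _) (here refl) Py only =
  trans (filter-accept P? Py) (cong (y ∷_) (filter-none P? (All.tabulate rejected)))
  where
  rejected : ∀ {x} → x ∈ xs → ¬ P x
  rejected x∈ Px = All.lookup y∉ x∈ (sym (only (there x∈) Px))
filter-singleton P? {z ∷ xs} (z∉ ∷ u) (there y∈) Py only with P? z
... | yes Pz = ⊥-elim (All.lookup z∉ y∈ (only (here refl) Pz))
... | no ¬Pz = filter-singleton P? u y∈ Py (only ∘ there)

module _ (p : Str → Bool) where

  accepts? : Decidable (λ x → p x ≡ true)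
  accepts? x = p x ≟ᵇ true

  rejects? : Decidable (λ x → p x ≡ false)
  rejects? x = p x ≟ᵇ false

stratify : ∀ {n} → Vec (Str → Bool) n → List Str → List Str
stratify []       xs = xs
stratify (p ∷ ps) xs = filter (accepts? p) xs ++ stratify ps (filter (rejects? p) xs)

∈-stratify⁻ : ∀ {n} (ps : Vec (Str → Bool) n) {xs x} → x ∈ stratify ps xs → x ∈ xs
∈-stratify⁻ []       x∈ = x∈
∈-stratify⁻ (p ∷ ps) {xs} x∈ with ∈-++⁻ (filter (accepts? p) xs) x∈
... | inj₁ x∈acc  = proj₁ (∈-filter⁻ (accepts? p) x∈acc)
... | inj₂ x∈rest = proj₁ (∈-filter⁻ (rejects? p) (∈-stratify⁻ ps x∈rest))

∈-stratify⁺ : ∀ {n} (ps : Vec (Str → Bool) n) {xs x} → x ∈ xs → x ∈ stratify ps xs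
∈-stratify⁺ []       x∈ = x∈
∈-stratify⁺ (p ∷ ps) {xs} {x} x∈ with p x in px
... | true  = ∈-++⁺ˡ (∈-filter⁺ (accepts? p) x∈ px)
... | false = ∈-++⁺ʳ _ (∈-stratify⁺ ps (∈-filter⁺ (rejects? p) x∈ px))

stratify-unique : ∀ {n} (ps : Vec (Str → Bool) n) {xs} → Unique xs → Unique (stratify ps xs)
stratify-unique []       u = u
stratify-unique (p ∷ ps) {xs} u =
  Unique.++⁺ (Unique.filter⁺ (accepts? p) u) (stratify-unique ps (Unique.filter⁺ (rejects? p) u))
    disjoint
  where
  disjoint : ∀ {x} → ¬ (x ∈ filter (accepts? p) xs × x ∈ stratify ps (filter (rejects? p) xs))
  disjoint (x∈acc , x∈rest) with proj₂ (∈-filter⁻ (accepts? p) {xs = xs} x∈acc)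
                               | proj₂ (∈-filter⁻ (rejects? p) {xs = xs} (∈-stratify⁻ ps x∈rest))
  ... | px≡true | px≡false = case trans (sym px≡true) px≡false of λ ()

stratify-Before : ∀ {n} (ps : Vec (Str → Bool) n) {xs x y} →
  VecAll.All (λ p → p y ≡ true → p x ≡ true) ps →
  Before xs x y → Before (stratify ps xs) x y
stratify-Before []       _ x<y = x<y
stratify-Before (p ∷ ps) {xs} {x} {y} (mono VecAll.∷ monos) x<y with p y in py
... | true  = Before-++ˡ _ (Before-filter (accepts? p) (mono refl) py x<y)
... | false with p x in px
...   | true  = Before-++ (∈-filter⁺ (accepts? p) (Before⇒∈ˡ x<y) px)
                          (∈-stratify⁺ ps (∈-filter⁺ (rejects? p) (Before⇒∈ʳ x<y) py))
...   | false = Before-++ʳ _ (stratify-Before ps monos (Before-filter (rejects? p) px py x<y))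

-- P is kept general since it stays fixed while a shrinks in the recursion.
stratify-hits : ∀ {n} (ps : Vec (Str → Bool) n) (a : Vec Str n)
  {P : Str → Set} (P? : Decidable P) {xs} → Unique xs → (∀ i → lookup a i ∈ xs) →
  (∀ {x} → x ∈ xs → P x → x ∈ toList a) → (∀ {x} → x ∈ toList a → P x) →
  (∀ i → lookup ps i (lookup a i) ≡ true) →
  (∀ i j → i <ᶠ j → lookup ps i (lookup a j) ≡ false) →
  filter P? (stratify ps xs) ≡ toList a
stratify-hits [] [] P? _ _ onlyA _ _ _ =
  filter-none P? (All.tabulate λ x∈ Px → case onlyA x∈ Px of λ ())
stratify-hits (p ∷ ps) (a₀ ∷ a) {P} P? {xs} u a⊆xs onlyA allA picks misses =
  begin
    filter P? (filter (accepts? p) xs ++ stratify ps (filter (rejects? p) xs))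
  ≡⟨ filter-++ P? (filter (accepts? p) xs) _ ⟩
    filter P? (filter (accepts? p) xs) ++ filter P? (stratify ps (filter (rejects? p) xs))
  ≡⟨ cong₂ _++_ first-block other-blocks ⟩
    a₀ ∷ toList a
  ∎
  where
  open ≡-Reasoning

  misses-later : ∀ {x} → x ∈ toList a → p x ≡ false
  misses-later x∈ with x∈a ← ∈-toList⁻ x∈ rewrite VecAny.lookup-index x∈a =
    misses zero (suc (VecAny.index x∈a)) (s≤s z≤n)

  first-block : filter P? (filter (accepts? p) xs) ≡ [ a₀ ]
  first-block =
    filter-singleton P? (Unique.filter⁺ (accepts? p) u)
      (∈-filter⁺ (accepts? p) (a⊆xs zero) (picks zero)) (allA (here refl)) only
    where
    only : ∀ {x} → x ∈ filter (accepts? p) xs → P x → x ≡ a₀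
    only x∈ Px with ∈-filter⁻ (accepts? p) x∈
    ... | x∈xs , px with onlyA x∈xs Px
    ...   | here x≡a₀  = x≡a₀
    ...   | there x∈a = case trans (sym px) (misses-later x∈a) of λ ()

  other-blocks : filter P? (stratify ps (filter (rejects? p) xs)) ≡ toList a
  other-blocks =
    stratify-hits ps a P? (Unique.filter⁺ (rejects? p) u)
      (λ i → ∈-filter⁺ (rejects? p) (a⊆xs (suc i)) (misses-later (∈-toList⁺ (∈-lookup i a))))
      only (allA ∘ there) (picks ∘ suc)
      (λ i j i<j → misses (suc i) (suc j) (s≤s i<j))
    where
    only : ∀ {x} → x ∈ filter (rejects? p) xs → P x → x ∈ toList a
    only x∈ Px with ∈-filter⁻ (rejects? p) x∈
    ... | x∈xs , px with onlyA x∈xs Px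
    ...   | here refl = case trans (sym (picks zero)) px of λ ()
    ...   | there x∈a = x∈a

preorder : ℕ → List Str
preorder zero    = [ [] ]
preorder (suc h) = [] ∷ map (false ∷_) (preorder h) ++ map (true ∷_) (preorder h)

∷-∈-subtrees : ∀ {h x} b → x ∈ preorder h →
  (b ∷ x) ∈ map (false ∷_) (preorder h) ++ map (true ∷_) (preorder h)
∷-∈-subtrees false x∈ = ∈-++⁺ˡ (∈-map⁺ (false ∷_) x∈)
∷-∈-subtrees true  x∈ = ∈-++⁺ʳ _ (∈-map⁺ (true ∷_) x∈)

∈-preorder⁺ : ∀ h x → length x ≤ h → x ∈ preorder h
∈-preorder⁺ zero    []      _       = here refl
∈-preorder⁺ (suc h) []      _       = here refl
∈-preorder⁺ (suc h) (b ∷ x) (s≤s l) = there (∷-∈-subtrees b (∈-preorder⁺ h x l))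

∈-preorder⁻ : ∀ h {x} → x ∈ preorder h → length x ≤ h
∈-preorder⁻ zero    (here refl) = z≤n
∈-preorder⁻ (suc h) (here refl) = z≤n
∈-preorder⁻ (suc h) (there x∈) with ∈-++⁻ (map (false ∷_) (preorder h)) x∈
... | inj₁ x∈₀ with _ , x′∈ , refl ← ∈-map⁻ (false ∷_) x∈₀ = s≤s (∈-preorder⁻ h x′∈)
... | inj₂ x∈₁ with _ , x′∈ , refl ← ∈-map⁻ (true ∷_) x∈₁ = s≤s (∈-preorder⁻ h x′∈)

preorder-unique : ∀ h → Unique (preorder h)
preorder-unique zero    = All.[] ∷ []
preorder-unique (suc h) =
  All.++⁺ (All.map⁺ {f = false ∷_} (All.universal (λ _ ()) (preorder h)))
          (All.map⁺ {f = true ∷_} (All.universal (λ _ ()) (preorder h))) ∷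
  Unique.++⁺ (Unique.map⁺ ∷-injectiveʳ (preorder-unique h))
             (Unique.map⁺ ∷-injectiveʳ (preorder-unique h)) disjoint
  where
  disjoint : ∀ {x} → ¬ (x ∈ map (false ∷_) (preorder h) × x ∈ map (true ∷_) (preorder h))
  disjoint (x∈₀ , x∈₁) with ∈-map⁻ (false ∷_) x∈₀ | ∈-map⁻ (true ∷_) x∈₁
  ... | _ , _ , refl | _ , _ , ()

∷-Before-preorder : ∀ {h x y} b → Before (preorder h) x y →
  Before (preorder (suc h)) (b ∷ x) (b ∷ y)
∷-Before-preorder false x<y = Before-++ʳ [ [] ] (Before-++ˡ _ (Before-map (false ∷_) x<y))
∷-Before-preorder true  x<y = Before-++ʳ ([] ∷ map (false ∷_) _) (Before-map (true ∷_) x<y)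

preorder-Before : ∀ h {x y} → x ⊑ y → x ≢ y → length y ≤ h → Before (preorder h) x y
preorder-Before h       {[]}    {[]}    _ x≢y _ = ⊥-elim (x≢y refl)
preorder-Before zero    {_}     {_ ∷ _} _ _ ()
preorder-Before (suc h) {[]}    {b ∷ y} _ _ (s≤s l) =
  Before-++ {xs = [ [] ]} (here refl) (∷-∈-subtrees b (∈-preorder⁺ h y l))
preorder-Before h       {_ ∷ _} {[]}    (_ , ()) _ _
preorder-Before (suc h) {b ∷ x} {.(b ∷ x ++ z)} (z , refl) x≢y (s≤s l) =
  ∷-Before-preorder b (preorder-Before h (z , refl) (x≢y ∘ cong (b ∷_)) l)

PrefixClosed : (Str → Bool) → Set
PrefixClosed p = ∀ {x y} → x ⊑ y → p y ≡ true → p x ≡ true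

stratifiedSchedule : ∀ h {n} (ps : Vec (Str → Bool) n) → VecAll.All PrefixClosed ps → Schedule h
stratifiedSchedule h ps closed = record
  { order    = stratify ps (preorder h)
  ; unique   = stratify-unique ps (preorder-unique h)
  ; sound    = λ _ x∈ → ∈-preorder⁻ h (∈-stratify⁻ ps x∈)
  ; complete = λ x x∈T → ∈-stratify⁺ ps (∈-preorder⁺ h x x∈T)
  ; monotone = λ _ _ _ y∈T x⊑y x≢y →
      stratify-Before ps (VecAll.map (λ closedₚ → closedₚ x⊑y) closed)
        (preorder-Before h x⊑y x≢y y∈T)
  }

bit : Str → ℕ → Maybe Bool
bit x k = head (drop k x)

-- An absent bit (the string is too short) is compatible with every pattern entry; this is what
-- makes matching a pattern prefix-closed.
compatible : Maybe Bool → Maybe Bool → Bool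
compatible nothing  _        = true
compatible (just _) nothing  = false
compatible (just u) (just v) = does (u ≟ᵇ v)

matches : ∀ {m} → Vec ℕ m → Vec (Maybe Bool) m → Str → Bool
matches []      []      x = true
matches (k ∷ Q) (e ∷ b) x = compatible (bit x k) e ∧ matches Q b x

profile : ∀ {m} → Vec ℕ m → Str → Vec (Maybe Bool) m
profile Q x = Vec.map (bit x) Q

DeviatesAt : Str → Str → ℕ → Set
DeviatesAt x y k = compatible (bit y k) (bit x k) ≡ false

compatible-refl : ∀ β → compatible β β ≡ true
compatible-refl nothing      = refl
compatible-refl (just false) = refl
compatible-refl (just true)  = refl

bit-prefix : ∀ x z k → bit x k ≡ nothing ⊎ bit x k ≡ bit (x ++ z) k
bit-prefix []      z zero    = inj₁ refl
bit-prefix []      z (suc k) = inj₁ refl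
bit-prefix (_ ∷ _) z zero    = inj₂ refl
bit-prefix (_ ∷ x) z (suc k) = bit-prefix x z k

compatible-prefix : ∀ {x y} k e → x ⊑ y →
  compatible (bit y k) e ≡ true → compatible (bit x k) e ≡ true
compatible-prefix {x} k e (z , refl) fits with bit-prefix x z k
... | inj₁ absent rewrite absent = refl
... | inj₂ same   rewrite same   = fits

matches-prefixClosed : ∀ {m} (Q : Vec ℕ m) b → PrefixClosed (matches Q b)
matches-prefixClosed []      []      _   _ = refl
matches-prefixClosed (k ∷ Q) (e ∷ b) {y = y} x⊑y y-matches
  with compatible (bit y k) e in fits | matches Q b y in rest
matches-prefixClosed (k ∷ Q) (e ∷ b) x⊑y refl | true | true =
  cong₂ _∧_ (compatible-prefix k e x⊑y fits) (matches-prefixClosed Q b x⊑y rest)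

matches-profile : ∀ {m} (Q : Vec ℕ m) x → matches Q (profile Q x) x ≡ true
matches-profile []      x = refl
matches-profile (k ∷ Q) x rewrite compatible-refl (bit x k) = matches-profile Q x

deviates⇒¬matches-profile : ∀ {m} (Q : Vec ℕ m) {x y} t → DeviatesAt x y (lookup Q t) →
  matches Q (profile Q x) y ≡ false
deviates⇒¬matches-profile (k ∷ Q) zero    deviates rewrite deviates = refl
deviates⇒¬matches-profile (k ∷ Q) {x} {y} (suc t) deviates with compatible (bit y k) (bit x k)
... | true  = deviates⇒¬matches-profile Q t deviates
... | false = refl

⊑-antisym : ∀ {x y} → x ⊑ y → y ⊑ x → x ≡ y
⊑-antisym {x} (z , refl) (w , x++z++w≡x) =
  trans (sym (++-identityʳ x)) (cong (x ++_) (sym z≡[]))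
  where
  z≡[] : z ≡ []
  z≡[] = ++-conicalˡ z w (++-identityʳ-unique x (sym (trans (sym (++-assoc x z w)) x++z++w≡x)))

⊑-∷ : ∀ {x y b} → x ⊑ y → (b ∷ x) ⊑ (b ∷ y)
⊑-∷ (z , refl) = z , refl

lcp : Str → Str → ℕ
lcp []          _           = 0
lcp (_ ∷ _)     []          = 0
lcp (false ∷ x) (false ∷ y) = suc (lcp x y)
lcp (true  ∷ x) (true  ∷ y) = suc (lcp x y)
lcp (false ∷ _) (true  ∷ _) = 0
lcp (true  ∷ _) (false ∷ _) = 0

lcp-sym : ∀ x y → lcp x y ≡ lcp y x
lcp-sym []          []          = refl
lcp-sym []          (_ ∷ _)     = refl
lcp-sym (_ ∷ _)     []          = refl
lcp-sym (false ∷ x) (false ∷ y) = cong suc (lcp-sym x y)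
lcp-sym (true  ∷ x) (true  ∷ y) = cong suc (lcp-sym x y)
lcp-sym (false ∷ x) (true  ∷ y) = refl
lcp-sym (true  ∷ x) (false ∷ y) = refl

lcp-≤-length : ∀ x y → lcp x y ≤ length x
lcp-≤-length (false ∷ x) (false ∷ y) = s≤s (lcp-≤-length x y)
lcp-≤-length (true  ∷ x) (true  ∷ y) = s≤s (lcp-≤-length x y)
lcp-≤-length []          _           = z≤n
lcp-≤-length (_ ∷ _)     []          = z≤n
lcp-≤-length (false ∷ x) (true  ∷ y) = z≤n
lcp-≤-length (true  ∷ x) (false ∷ y) = z≤n

lcp≡length⇒⊑ : ∀ x y → lcp x y ≡ length x → x ⊑ y
lcp≡length⇒⊑ []          y           _  = y , refl
lcp≡length⇒⊑ (false ∷ x) (false ∷ y) eq = ⊑-∷ (lcp≡length⇒⊑ x y (suc-injective eq))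
lcp≡length⇒⊑ (true  ∷ x) (true  ∷ y) eq = ⊑-∷ (lcp≡length⇒⊑ x y (suc-injective eq))
lcp≡length⇒⊑ (_ ∷ _)     []          ()
lcp≡length⇒⊑ (false ∷ x) (true  ∷ y) ()
lcp≡length⇒⊑ (true  ∷ x) (false ∷ y) ()

lcp-ultrametric : ∀ x y z → lcp x y < lcp y z → lcp x z ≡ lcp x y
lcp-ultrametric (false ∷ x) (false ∷ y) (false ∷ z) (s≤s l) = cong suc (lcp-ultrametric x y z l)
lcp-ultrametric (true  ∷ x) (true  ∷ y) (true  ∷ z) (s≤s l) = cong suc (lcp-ultrametric x y z l)
lcp-ultrametric []          _           _           _  = refl
lcp-ultrametric (false ∷ x) (true  ∷ y) (true  ∷ z) _  = refl
lcp-ultrametric (true  ∷ x) (false ∷ y) (false ∷ z) _  = refl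
lcp-ultrametric (_ ∷ _)     []          _           ()
lcp-ultrametric (false ∷ x) (false ∷ y) []          ()
lcp-ultrametric (true  ∷ x) (true  ∷ y) []          ()
lcp-ultrametric (false ∷ x) (false ∷ y) (true  ∷ z) ()
lcp-ultrametric (true  ∷ x) (true  ∷ y) (false ∷ z) ()
lcp-ultrametric (false ∷ x) (true  ∷ y) []          ()
lcp-ultrametric (true  ∷ x) (false ∷ y) []          ()
lcp-ultrametric (false ∷ x) (true  ∷ y) (false ∷ z) ()
lcp-ultrametric (true  ∷ x) (false ∷ y) (true  ∷ z) ()

deviatesAt-lcp : ∀ x y → lcp x y < length x → lcp x y < length y → DeviatesAt x y (lcp x y)
deviatesAt-lcp (false ∷ x) (false ∷ y) (s≤s lx) (s≤s ly) = deviatesAt-lcp x y lx ly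
deviatesAt-lcp (true  ∷ x) (true  ∷ y) (s≤s lx) (s≤s ly) = deviatesAt-lcp x y lx ly
deviatesAt-lcp (false ∷ x) (true  ∷ y) _ _ = refl
deviatesAt-lcp (true  ∷ x) (false ∷ y) _ _ = refl

bit-beyond : ∀ x {k} → length x ≤ k → bit x k ≡ nothing
bit-beyond []      {zero}  _       = refl
bit-beyond []      {suc k} _       = refl
bit-beyond (_ ∷ x) {suc k} (s≤s l) = bit-beyond x l

bit-within : ∀ y {k} → k < length y → ∃ λ u → bit y k ≡ just u
bit-within (u ∷ _) {zero}  _       = u , refl
bit-within (_ ∷ y) {suc k} (s≤s l) = bit-within y l

deviatesAt-beyond : ∀ x y {k} → length x ≤ k → k < length y → DeviatesAt x y k
deviatesAt-beyond x y x-short y-long with u , y-has-u ← bit-within y y-long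
  rewrite y-has-u | bit-beyond x x-short = refl

module BranchingDepths (A : ℕ → Str) where

  partner : ℕ → ℕ
  partner j = argmax (λ k → lcp (A j) (A k)) 0 (upTo j)

  -- depth 0 is junk (partner 0 = 0); only the depths of j ≥ 1 are used.
  depth : ℕ → ℕ
  depth j = lcp (A j) (A (partner j))

  partner< : ∀ {j} → 0 < j → partner j < j
  partner< {j} 0<j =
    argmax-all (λ k → lcp (A j) (A k)) {P = _< j} {xs = upTo j} 0<j (All.tabulate ∈-upTo⁻)

  lcp≤depth : ∀ {i j} → i < j → lcp (A i) (A j) ≤ depth j
  lcp≤depth {i} {j} i<j =
    subst (_≤ depth j) (lcp-sym (A j) (A i))
      (All.lookup (f[xs]≤f[argmax] {f = λ k → lcp (A j) (A k)} 0 (upTo j)) (∈-upTo⁺ i<j))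

  BranchesAtDepth : ℕ → ℕ → Set
  BranchesAtDepth i j = ∃ λ j′ → 0 < j′ × j′ ≤ j × depth j′ ≡ lcp (A i) (A j)

  -- If lcp(A i, A j) < depth j, the partner m of j satisfies lcp(A i, A m) = lcp(A i, A j) by the
  -- ultrametric inequality, and since i, m < j induction applies to the pair {i, m}.
  lcp-is-depth : ∀ j {i} → i < j → BranchesAtDepth i j
  lcp-is-depth = <-rec (λ j → ∀ {i} → i < j → BranchesAtDepth i j) step
    where
    step : ∀ j → (∀ {k} → k < j → ∀ {i} → i < k → BranchesAtDepth i k) →
           ∀ {i} → i < j → BranchesAtDepth i j
    step j ih {i} i<j with m≤n⇒m<n∨m≡n (lcp≤depth i<j)
    ... | inj₂ lcp≡depth = j , ≤-<-trans z≤n i<j , ≤-refl , sym lcp≡depth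
    ... | inj₁ lcp<depth = via-partner (<-cmp i m)
      where
      m = partner j

      m<j : m < j
      m<j = partner< (≤-<-trans z≤n i<j)

      lcp-im≡lcp-ij : lcp (A i) (A m) ≡ lcp (A i) (A j)
      lcp-im≡lcp-ij = lcp-ultrametric (A i) (A j) (A m) lcp<depth

      via-partner : Tri (i < m) (i ≡ m) (m < i) → BranchesAtDepth i j
      via-partner (tri< i<m _ _) with j′ , 0<j′ , j′≤m , eq ← ih m<j i<m =
        j′ , 0<j′ , ≤-trans j′≤m (<⇒≤ m<j) , trans eq lcp-im≡lcp-ij
      via-partner (tri≈ _ i≡m _) =
        contradiction lcp<depth
          (<-irrefl (trans (lcp-sym (A i) (A j)) (cong (λ k → lcp (A j) (A k)) i≡m)))
      via-partner (tri> _ _ m<i) with j′ , 0<j′ , j′≤i , eq ← ih i<j m<i =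
        j′ , 0<j′ , ≤-trans j′≤i (<⇒≤ i<j) , trans eq (trans (lcp-sym (A m) (A i)) lcp-im≡lcp-ij)

  -- Admissibility of a tuple is used only through this consequence.
  module _ {n} (later⋢earlier : ∀ {i j} → i < j → j < n → ¬ (A j ⊑ A i)) where

    depth<length : ∀ {j} → 0 < j → j < n → depth j < length (A j)
    depth<length {j} 0<j j<n =
      ≤∧≢⇒< (lcp-≤-length (A j) (A (partner j)))
        (later⋢earlier (partner< 0<j) j<n ∘ lcp≡length⇒⊑ (A j) (A (partner j)))

    separating-depth : ∀ {i j} → i < j → j < n →
      ∃ λ j′ → 0 < j′ × j′ < n × DeviatesAt (A i) (A j) (depth j′)
    -- If A i ⊑ A j, then A j still has a bit at depth j, beyond the end of A i; otherwise
    -- A i and A j differ at their branching depth, which is the depth of some j′ ≤ j.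
    separating-depth {i} {j} i<j j<n with lcp (A i) (A j) ≟ length (A i)
    ... | yes lcp≡length =
      j , 0<j , j<n ,
      deviatesAt-beyond (A i) (A j) (subst (_≤ depth j) lcp≡length (lcp≤depth i<j))
        (depth<length 0<j j<n)
      where 0<j = ≤-<-trans z≤n i<j
    ... | no lcp≢length with j′ , 0<j′ , j′≤j , eq ← lcp-is-depth j i<j =
      j′ , 0<j′ , ≤-<-trans j′≤j j<n ,
      subst (DeviatesAt (A i) (A j)) (sym eq) (deviatesAt-lcp (A i) (A j) short-i short-j)
      where
      short-i : lcp (A i) (A j) < length (A i)
      short-i = ≤∧≢⇒< (lcp-≤-length (A i) (A j)) lcp≢length
      short-j : lcp (A i) (A j) < length (A j)
      short-j = subst (_< length (A j)) (lcp-sym (A j) (A i))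
        (≤∧≢⇒< (lcp-≤-length (A j) (A i)) (later⋢earlier i<j j<n ∘ lcp≡length⇒⊑ (A j) (A i)))

vectors : ∀ {X : Set} → List X → (k : ℕ) → List (Vec X k)
vectors xs zero    = [ [] ]
vectors xs (suc k) = cartesianProductWith _∷_ xs (vectors xs k)

length-cartesianProductWith : ∀ {X Y Z : Set} (f : X → Y → Z) xs ys →
  length (cartesianProductWith f xs ys) ≡ length xs * length ys
length-cartesianProductWith f []       ys = refl
length-cartesianProductWith f (x ∷ xs) ys = begin
  length (map (f x) ys ++ cartesianProductWith f xs ys)
    ≡⟨ length-++ (map (f x) ys) ⟩
  length (map (f x) ys) + length (cartesianProductWith f xs ys)
    ≡⟨ cong₂ _+_ (length-map (f x) ys) (length-cartesianProductWith f xs ys) ⟩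
  length ys + length xs * length ys
    ∎
  where open ≡-Reasoning

length-vectors : ∀ {X : Set} (xs : List X) k → length (vectors xs k) ≡ length xs ^ k
length-vectors xs zero    = refl
length-vectors xs (suc k) =
  trans (length-cartesianProductWith _∷_ xs (vectors xs k))
        (cong (length xs *_) (length-vectors xs k))

∈-vectors : ∀ {X : Set} {xs : List X} {k} {v : Vec X k} → VecAll.All (_∈ xs) v → v ∈ vectors xs k
∈-vectors VecAll.[]           = here refl
∈-vectors (x∈ VecAll.∷ v∈xs) = ∈-cartesianProductWith⁺ _∷_ x∈ (∈-vectors v∈xs)

maybeBools : List (Maybe Bool)
maybeBools = nothing ∷ just false ∷ just true ∷ []

∈-maybeBools : ∀ β → β ∈ maybeBools
∈-maybeBools nothing      = here refl
∈-maybeBools (just false) = there (here refl)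
∈-maybeBools (just true)  = there (there (here refl))

patternSchedule : ∀ h {m n} → Vec ℕ m → Vec (Vec (Maybe Bool) m) n → Schedule h
patternSchedule h Q B =
  stratifiedSchedule h (Vec.map (matches Q) B)
    (VecAll.map⁺ (VecAll.universal (matches-prefixClosed Q) B))

patternSchedules : ∀ h m → List (Schedule h)
patternSchedules h m =
  cartesianProductWith (patternSchedule h)
    (vectors (upTo h) m) (vectors (vectors maybeBools m) (suc m))

length-patternSchedules : ∀ h m → length (patternSchedules h m) ≡ h ^ m * (3 ^ m) ^ suc m
length-patternSchedules h m =
  trans (length-cartesianProductWith (patternSchedule h) (vectors (upTo h) m) _)
    (cong₂ _*_ (trans (length-vectors (upTo h) m) (cong (_^ m) (length-upTo h)))
               (trans (length-vectors (vectors maybeBools m) (suc m))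
                      (cong (_^ suc m) (length-vectors maybeBools m))))

lookupℕ : ∀ {n} → Vec Str n → ℕ → Str
lookupℕ []       _       = []
lookupℕ (x ∷ _)  zero    = x
lookupℕ (_ ∷ xs) (suc k) = lookupℕ xs k

lookupℕ-toℕ : ∀ {n} (xs : Vec Str n) i → lookupℕ xs (toℕ i) ≡ lookup xs i
lookupℕ-toℕ (x ∷ _)  zero    = refl
lookupℕ-toℕ (_ ∷ xs) (suc i) = lookupℕ-toℕ xs i

lookupℕ-fromℕ< : ∀ {n} (xs : Vec Str n) {k} (k<n : k < n) → lookupℕ xs k ≡ lookup xs (fromℕ< k<n)
lookupℕ-fromℕ< xs k<n =
  trans (cong (lookupℕ xs) (sym (Fin.toℕ-fromℕ< k<n))) (lookupℕ-toℕ xs (fromℕ< k<n))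

admissible⇒later⋢earlier : ∀ {h n} {a : Vec Str n} → Admissible h n a →
  ∀ {i j} → i <ᶠ j → ¬ (lookup a j ⊑ lookup a i)
admissible⇒later⋢earlier (_ , distinct , comparable) {i} {j} i<j aj⊑ai with comparable i j i<j
... | inj₁ ai⊑aj       = Fin.<-irrefl (distinct i j (⊑-antisym ai⊑aj aj⊑ai)) i<j
... | inj₂ (_ , aj⋢ai) = aj⋢ai aj⊑ai

admissible⇒later⋢earlierℕ : ∀ {h n} {a : Vec Str n} → Admissible h n a →
  ∀ {i j} → i < j → j < n → ¬ (lookupℕ a j ⊑ lookupℕ a i)
admissible⇒later⋢earlierℕ {a = a} adm {i} {j} i<j j<n =
  subst₂ (λ y x → ¬ (y ⊑ x)) (sym (lookupℕ-fromℕ< a j<n)) (sym (lookupℕ-fromℕ< a i<n))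
    (admissible⇒later⋢earlier {a = a} adm fromℕ<-i<fromℕ<-j)
  where
  i<n = <-trans i<j j<n
  fromℕ<-i<fromℕ<-j : fromℕ< i<n <ᶠ fromℕ< j<n
  fromℕ<-i<fromℕ<-j = subst₂ _<_ (sym (Fin.toℕ-fromℕ< i<n)) (sym (Fin.toℕ-fromℕ< j<n)) i<j

-- The depths q₂, …, q_d; with 0-based indices these are the depths of positions 1, …, m.
branchDepths : ∀ {m} → Vec Str (suc m) → Vec ℕ m
branchDepths a = Vec.tabulate (BranchingDepths.depth (lookupℕ a) ∘ suc ∘ toℕ)

DeviatesAt-cong : ∀ {x x′ y y′ k k′} → x ≡ x′ → y ≡ y′ → k ≡ k′ →
  DeviatesAt x y k → DeviatesAt x′ y′ k′
DeviatesAt-cong refl refl refl deviates = deviates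

module _ {h m} (a : Vec Str (suc m)) (adm : Admissible h (suc m) a) where

  open BranchingDepths (lookupℕ a)

  private
    later⋢earlier : ∀ {i j} → i < j → j < suc m → ¬ (lookupℕ a j ⊑ lookupℕ a i)
    later⋢earlier = admissible⇒later⋢earlierℕ {a = a} adm

    depth∈branchDepths : ∀ {j} → 0 < j → j < suc m → ∃ λ t → lookup (branchDepths a) t ≡ depth j
    depth∈branchDepths {suc j} _ (s≤s j<m) =
      fromℕ< j<m ,
      trans (lookup∘tabulate _ (fromℕ< j<m)) (cong (depth ∘ suc) (Fin.toℕ-fromℕ< j<m))

  branchDepths-< : VecAll.All (_< h) (branchDepths a)
  branchDepths-< = VecAll.tabulate⁺ λ t →
    <-≤-trans (depth<length later⋢earlier z<s (s≤s (Fin.toℕ<n t)))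
      (subst (λ x → length x ≤ h) (sym (lookupℕ-toℕ a (suc t))) (proj₁ adm (suc t)))

  branchDepths-separate : ∀ {i j} → i <ᶠ j →
    ∃ λ t → DeviatesAt (lookup a i) (lookup a j) (lookup (branchDepths a) t)
  branchDepths-separate {i} {j} i<j =
    at-branchDepth (separating-depth later⋢earlier i<j (Fin.toℕ<n j))
    where
    at-branchDepth :
      (∃ λ j′ → 0 < j′ × j′ < suc m ×
                DeviatesAt (lookupℕ a (toℕ i)) (lookupℕ a (toℕ j)) (depth j′)) →
      ∃ λ t → DeviatesAt (lookup a i) (lookup a j) (lookup (branchDepths a) t)
    at-branchDepth (j′ , 0<j′ , j′<n , deviates) =
      let t , Qt≡depth = depth∈branchDepths 0<j′ j′<n in
      t , DeviatesAt-cong (lookupℕ-toℕ a i) (lookupℕ-toℕ a j) (sym Qt≡depth) deviates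

lookup-profile-patterns : ∀ {m n} (Q : Vec ℕ m) (a : Vec Str n) i y →
  lookup (Vec.map (matches Q) (Vec.map (profile Q) a)) i y ≡ matches Q (profile Q (lookup a i)) y
lookup-profile-patterns Q a i y =
  trans (cong-app (lookup-map i (matches Q) (Vec.map (profile Q) a)) y)
        (cong (λ b → matches Q b y) (lookup-map i (profile Q) a))

profile-picks : ∀ {m n} (Q : Vec ℕ m) (a : Vec Str n) i →
  lookup (Vec.map (matches Q) (Vec.map (profile Q) a)) i (lookup a i) ≡ true
profile-picks Q a i = trans (lookup-profile-patterns Q a i _) (matches-profile Q (lookup a i))

profile-misses : ∀ {m n} (Q : Vec ℕ m) (a : Vec Str n) {i j} →
  (∃ λ t → DeviatesAt (lookup a i) (lookup a j) (lookup Q t)) →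
  lookup (Vec.map (matches Q) (Vec.map (profile Q) a)) i (lookup a j) ≡ false
profile-misses Q a {i} (t , deviates) =
  trans (lookup-profile-patterns Q a i _) (deviates⇒¬matches-profile Q t deviates)

patternSchedules-hitting : ∀ h m → Hitting h (suc m) (patternSchedules h m)
patternSchedules-hitting h m a adm =
  patternSchedule h Q B , ∈-cartesianProductWith⁺ (patternSchedule h) Q∈ B∈ , hits
  where
  Q = branchDepths a
  B = Vec.map (profile Q) a

  Q∈ : Q ∈ vectors (upTo h) m
  Q∈ = ∈-vectors (VecAll.map ∈-upTo⁺ (branchDepths-< a adm))

  B∈ : B ∈ vectors (vectors maybeBools m) (suc m)
  B∈ = ∈-vectors (VecAll.universal (λ b → ∈-vectors (VecAll.universal ∈-maybeBools b)) B)

  hits : Hits (patternSchedule h Q B) a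
  hits = stratify-hits (Vec.map (matches Q) B) a _ (preorder-unique h)
           (λ i → ∈-preorder⁺ h _ (proj₁ adm i)) (λ _ x∈a → x∈a) (λ x∈a → x∈a)
           (profile-picks Q a) (λ _ _ → profile-misses Q a ∘ branchDepths-separate a adm)

theorem3 : ∀ (d : ℕ) → 3 ≤ d →
    Σ ℕ λ f → ∀ (h : ℕ) → 1 ≤ h →
      Σ (List (Schedule h)) λ F → Hitting h d F × length F ≤ f * h ^ (d ∸ 1)
theorem3 (suc m) _ = (3 ^ m) ^ suc m , λ h _ →
  patternSchedules h m , patternSchedules-hitting h m ,
  ≤-reflexive (trans (length-patternSchedules h m) (*-comm (h ^ m) _))
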